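{- Let $\mathbf w=(q_0,\dots,q_n)$ be positive integer weights, let $q=\gcd(q_0,\dots,q_n)$ and write $q_i=q\,\bar q_i$. Let $\mathbf x=(x_0,\dots,x_n)$ be a tuple of integers with \[ x_i=\prod_{j=1}^t p_j^{\alpha_{j,i}},\qquad \alpha_{j,i}\ge 0,\quad i=0,\dots,n, \] where $p_1,\dots,p_t$ are distinct primes. Then the absolute weighted greatest common divisor of $\mathbf x$ is \[ \mathrm{awgcd}(\mathbf x)=\Big(\prod_{j=1}^t p_j^{\alpha_j}\Big)^{1/q},\qquad \alpha_j=\min\left\{\left\lfloor \frac{\alpha_{j,i}}{\bar q_i}\right\rfloor : i=0,\dots,n\right\}. \]
   Context: For a tuple of integers $\mathbf x=(x_0,\dots,x_n)$, not all zero, and weights $\mathbf w=(q_0,\dots,q_n)$ (positive integers), the absolute weighted greatest common divisor $\mathrm{awgcd}(\mathbf x)$ is the largest positive real number $d$ such that for every $i=0,\dots,n$, $d^{q_i}$ is an integer and $d^{q_i}\mid x_i$. $\lfloor\cdot\rfloor$ denotes the integer part. -}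

module Defs where

open import Data.Nat using (ℕ; zero; suc; _*_; _^_; _≤_; _<_; _⊓_; _/_)
open import Data.Nat.GCD using (gcd)
open import Data.Nat.Divisibility using (_∣_)
open import Data.Fin using (Fin; zero; suc)
open import Data.Product using (_×_)
open import Relation.Binary.PropositionalEquality using (_≡_)

prodF : ∀ {t} → (Fin t → ℕ) → ℕ
prodF {zero}  f = 1
prodF {suc t} f = f zero * prodF (λ j → f (suc j))

minF : ∀ {n} → (Fin (suc n) → ℕ) → ℕ
minF {zero}  f = f zero
minF {suc n} f = f zero ⊓ minF (λ i → f (suc i))

gcdF : ∀ {n} → (Fin (suc n) → ℕ) → ℕ
gcdF {zero}  f = f zero
gcdF {suc n} f = gcd (f zero) (gcdF (λ i → f (suc i)))

-- integer part of a / b (only used with b > 0; value 0 for b = 0 is a convention)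
_div_ : ℕ → ℕ → ℕ
a div zero    = 0
a div (suc k) = a / suc k

-- Encoding of positive reals d with all d^{q_i} integral:
-- such a d is represented by the tuple y with y i = d^{q_i}.
-- A tuple of positive integers y comes from a (unique) positive real d
-- iff y i ^ q j ≡ y j ^ q i for all i j (take d = (y 0)^{1/q_0}).
IsPowerTuple : ∀ {n} → (q : Fin (suc n) → ℕ) → (y : Fin (suc n) → ℕ) → Set
IsPowerTuple q y = (∀ i → 0 < y i) × (∀ i j → y i ^ q j ≡ y j ^ q i)

Admissible : ∀ {n} → (q x y : Fin (suc n) → ℕ) → Set
Admissible q x y = IsPowerTuple q y × (∀ i → y i ∣ x i)

-- d (encoded by y) is awgcd(x): admissible and largest among admissible d'.
-- For positive reals, d' ≤ d iff d'^{q_0} ≤ d^{q_0}.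
IsAwgcd : ∀ {n} → (q x y : Fin (suc n) → ℕ) → Set
IsAwgcd q x y = Admissible q x y × (∀ y′ → Admissible q x y′ → y′ zero ≤ y zero)

-- Everything is decided one prime p at a time. For admissible d the relations
-- (d^{q_i})^{q_l} = (d^{q_l})^{q_i} make the p-adic valuations of the d^{q_i} proportional to
-- the weights, and since q̄ = q / gcd q is primitive they are s·q̄_i for one integer s
-- (morally s = q·v_p(d)). For p = p_j, d^{q_i} ∣ x_i then says s·q̄_i ≤ α_{j,i} for all i, that
-- is s ≤ α_j. So d^{q_0} divides (∏ p_j^{α_j})^{q̄_0}, a bound attained by d = (∏ p_j^{α_j})^{1/q}.

module Submission where

open import Defs
open import Data.Nat using (ℕ; zero; suc; _+_; _∸_; _*_; _^_; _≤_; _<_; z≤n; s≤s; NonZero; >-nonZero; nonTrivial⇒n>1; nonTrivial⇒≢1)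
open import Data.Nat.Properties
open import Data.Nat.Divisibility
open import Data.Nat.DivMod using (_/_; m/n*n≤m; m/n*n≡m; m*n/n≡m; /-monoˡ-≤)
open import Data.Nat.GCD using (gcd; gcd[m,n]∣m; gcd[m,n]∣n; gcd-greatest; c*gcd[m,n]≡gcd[cm,cn])
open import Data.Nat.Coprimality using (Coprime; coprime-divisor)
open import Data.Nat.Primality using (Prime; prime⇒irreducible; prime⇒nonZero; prime⇒nonTrivial; euclidsLemma)
open import Data.Nat.Induction using (<-rec)
open import Algebra.Properties.CommutativeSemigroup *-commutativeSemigroup using (interchange; x∙yz≈y∙xz)
open import Data.Fin using (Fin; zero; suc)
import Data.Fin.Properties as Fin
open import Data.Vec.Functional using (_∷_)
open import Data.Product using (∃; _,_; proj₁; proj₂; map₂)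
open import Data.Sum using (inj₁; inj₂; [_,_]′)
open import Relation.Nullary using (yes; no; contradiction)
open import Relation.Binary.PropositionalEquality
open import Function using (_∘_)

variable
  n t : ℕ
  a b d p r k l : ℕ

div*≤ : ∀ a {b} → 0 < b → a div b * b ≤ a
div*≤ a {suc b} _ = m/n*n≤m a (suc b)

div*≡ : ∀ a {b} → 0 < b → b ∣ a → a div b * b ≡ a
div*≡ a {suc b} _ = m/n*n≡m

*≤⇒≤div : ∀ {s a b} → 0 < b → s * b ≤ a → s ≤ a div b
*≤⇒≤div {s} {a} {suc b} _ s*b≤a =
  subst (_≤ a / suc b) (m*n/n≡m s (suc b)) (/-monoˡ-≤ (suc b) s*b≤a)

∣⇒>0 : 0 < b → a ∣ b → 0 < a
∣⇒>0 {a = zero}  b>0 0∣b = contradiction (0∣⇒≡0 0∣b) (n>0⇒n≢0 b>0)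
∣⇒>0 {a = suc a} _   _   = s≤s z≤n

^-monoʳ-∣ : ∀ p → k ≤ l → p ^ k ∣ p ^ l
^-monoʳ-∣ {k} {l} p k≤l = divides (p ^ (l ∸ k)) (begin
  p ^ l                 ≡⟨ cong (p ^_) (sym (m+[n∸m]≡n k≤l)) ⟩
  p ^ (k + (l ∸ k))     ≡⟨ ^-distribˡ-+-* p k (l ∸ k) ⟩
  p ^ k * p ^ (l ∸ k)   ≡⟨ *-comm (p ^ k) _ ⟩
  p ^ (l ∸ k) * p ^ k   ∎)
  where open ≡-Reasoning

^-distribʳ-* : ∀ a b e → (a * b) ^ e ≡ a ^ e * b ^ e
^-distribʳ-* a b zero    = refl
^-distribʳ-* a b (suc e) = begin
  a * b * (a * b) ^ e       ≡⟨ cong (a * b *_) (^-distribʳ-* a b e) ⟩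
  a * b * (a ^ e * b ^ e)   ≡⟨ interchange a b (a ^ e) (b ^ e) ⟩
  a * a ^ e * (b * b ^ e)   ∎
  where open ≡-Reasoning

minF≤ : (f : Fin (suc n) → ℕ) → ∀ i → minF f ≤ f i
minF≤ {zero}  f zero    = ≤-refl
minF≤ {suc n} f zero    = m⊓n≤m (f zero) _
minF≤ {suc n} f (suc i) = ≤-trans (m⊓n≤n (f zero) _) (minF≤ (f ∘ suc) i)

minF-glb : ∀ {s} (f : Fin (suc n) → ℕ) → (∀ i → s ≤ f i) → s ≤ minF f
minF-glb {zero}  f s≤f = s≤f zero
minF-glb {suc n} f s≤f = ⊓-glb (s≤f zero) (minF-glb (f ∘ suc) (s≤f ∘ suc))

minF-div*≤ : (A r : Fin (suc n) → ℕ) → ∀ i → 0 < r i → minF (λ i → A i div r i) * r i ≤ A i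
minF-div*≤ A r i r>0 = ≤-trans (*-monoˡ-≤ (r i) (minF≤ _ i)) (div*≤ (A i) r>0)

*≤⇒≤minF-div : ∀ {s} (A r : Fin (suc n) → ℕ) → (∀ i → 0 < r i) → (∀ i → s * r i ≤ A i)
  → s ≤ minF (λ i → A i div r i)
*≤⇒≤minF-div A r r>0 s*r≤A = minF-glb _ (λ i → *≤⇒≤div (r>0 i) (s*r≤A i))

gcdF∣ : (f : Fin (suc n) → ℕ) → ∀ i → gcdF f ∣ f i
gcdF∣ {zero}  f zero    = ∣-refl
gcdF∣ {suc n} f zero    = gcd[m,n]∣m (f zero) _
gcdF∣ {suc n} f (suc i) = ∣-trans (gcd[m,n]∣n (f zero) _) (gcdF∣ (f ∘ suc) i)

gcdF-greatest : (f : Fin (suc n) → ℕ) → (∀ i → d ∣ f i) → d ∣ gcdF f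
gcdF-greatest {zero}  f d∣f = d∣f zero
gcdF-greatest {suc n} f d∣f = gcd-greatest (d∣f zero) (gcdF-greatest (f ∘ suc) (d∣f ∘ suc))

c*gcdF≡gcdF[c*] : ∀ c (f : Fin (suc n) → ℕ) → c * gcdF f ≡ gcdF (λ i → c * f i)
c*gcdF≡gcdF[c*] {zero}  c f = refl
c*gcdF≡gcdF[c*] {suc n} c f = begin
  c * gcd (f zero) (gcdF (f ∘ suc))          ≡⟨ c*gcd[m,n]≡gcd[cm,cn] c (f zero) _ ⟩
  gcd (c * f zero) (c * gcdF (f ∘ suc))      ≡⟨ cong (gcd (c * f zero)) (c*gcdF≡gcdF[c*] c (f ∘ suc)) ⟩
  gcd (c * f zero) (gcdF (λ i → c * f (suc i))) ∎
  where open ≡-Reasoning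

prodF>0 : (f : Fin t → ℕ) → (∀ j → 0 < f j) → 0 < prodF f
prodF>0 {zero}  f f>0 = s≤s z≤n
prodF>0 {suc t} f f>0 = *-mono-≤ (f>0 zero) (prodF>0 (f ∘ suc) (f>0 ∘ suc))

prodF-cong : (f g : Fin t → ℕ) → (∀ j → f j ≡ g j) → prodF f ≡ prodF g
prodF-cong {zero}  f g f≡g = refl
prodF-cong {suc t} f g f≡g = cong₂ _*_ (f≡g zero) (prodF-cong (f ∘ suc) (g ∘ suc) (f≡g ∘ suc))

prodF-pres-∣ : (f g : Fin t → ℕ) → (∀ j → f j ∣ g j) → prodF f ∣ prodF g
prodF-pres-∣ {zero}  f g f∣g = ∣-refl
prodF-pres-∣ {suc t} f g f∣g = *-pres-∣ (f∣g zero) (prodF-pres-∣ (f ∘ suc) (g ∘ suc) (f∣g ∘ suc))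

prodF-^ : (f : Fin t → ℕ) → ∀ e → prodF f ^ e ≡ prodF (λ j → f j ^ e)
prodF-^ {zero}  f e = ^-zeroˡ e
prodF-^ {suc t} f e = begin
  (f zero * prodF (f ∘ suc)) ^ e         ≡⟨ ^-distribʳ-* (f zero) _ e ⟩
  f zero ^ e * prodF (f ∘ suc) ^ e       ≡⟨ cong (f zero ^ e *_) (prodF-^ (f ∘ suc) e) ⟩
  f zero ^ e * prodF (λ j → f (suc j) ^ e) ∎
  where open ≡-Reasoning

prime>1 : Prime p → 1 < p
prime>1 {p} p-prime = nonTrivial⇒n>1 p {{prime⇒nonTrivial p-prime}}

prime∤1 : Prime p → p ∤ 1
prime∤1 p-prime p∣1 = nonTrivial⇒≢1 {{prime⇒nonTrivial p-prime}} (∣1⇒≡1 p∣1)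

prime∤prime : Prime p → Prime r → p ≢ r → p ∤ r
prime∤prime p-prime r-prime p≢r p∣r =
  [ nonTrivial⇒≢1 {{prime⇒nonTrivial p-prime}} , p≢r ]′ (prime⇒irreducible r-prime p∣r)

prime∤⇒coprime : Prime p → p ∤ a → Coprime a p
prime∤⇒coprime p-prime p∤a (d∣a , d∣p) with prime⇒irreducible p-prime d∣p
... | inj₁ d≡1 = d≡1
... | inj₂ refl = contradiction d∣a p∤a

record Valuation (p a k : ℕ) : Set where
  constructor valuation
  field
    cofactor     : ℕ
    factorised   : a ≡ p ^ k * cofactor
    p∤cofactor   : p ∤ cofactor

module _ (p-prime : Prime p) where

  private
    instance
      p≢0 : NonZero p
      p≢0 = prime⇒nonZero p-prime

  valuation-mono-∣ : Valuation p a k → Valuation p b l → a ∣ b → k ≤ l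
  valuation-mono-∣ {k = k} {l = l} (valuation c refl _) (valuation d refl p∤d) a∣b with k ≤? l
  ... | yes k≤l = k≤l
  ... | no  k≰l = contradiction (*-cancelˡ-∣ (p ^ l) {{m^n≢0 p l}} p^l*p∣p^l*d) p∤d
    where
    p^l*p∣p^l*d : p ^ l * p ∣ p ^ l * d
    p^l*p∣p^l*d = ∣-trans (∣-reflexive (*-comm (p ^ l) p))
                 (∣-trans (^-monoʳ-∣ p (≰⇒> k≰l)) (∣-trans (m∣m*n c) a∣b))

  valuation-unique : Valuation p a k → Valuation p a l → k ≡ l
  valuation-unique v w = ≤-antisym (valuation-mono-∣ v w ∣-refl) (valuation-mono-∣ w v ∣-refl)

  valuation-1 : Valuation p 1 0
  valuation-1 = valuation 1 refl (prime∤1 p-prime)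

  valuation-self : Valuation p p 1
  valuation-self = valuation 1 (sym (trans (*-identityʳ _) (*-identityʳ p))) (prime∤1 p-prime)

  valuation-prime : Prime r → p ≢ r → Valuation p r 0
  valuation-prime r-prime p≢r = valuation _ (sym (+-identityʳ _)) (prime∤prime p-prime r-prime p≢r)

  valuation-* : Valuation p a k → Valuation p b l → Valuation p (a * b) (k + l)
  valuation-* {k = k} {l = l} (valuation c refl p∤c) (valuation d refl p∤d) =
    valuation (c * d) (begin
      p ^ k * c * (p ^ l * d)   ≡⟨ interchange (p ^ k) c (p ^ l) d ⟩
      p ^ k * p ^ l * (c * d)   ≡⟨ cong (_* (c * d)) (^-distribˡ-+-* p k l) ⟨
      p ^ (k + l) * (c * d)     ∎)
      ([ p∤c , p∤d ]′ ∘ euclidsLemma c d p-prime)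
    where open ≡-Reasoning

  valuation-^ : Valuation p a k → ∀ e → Valuation p (a ^ e) (k * e)
  valuation-^ {k = k} v zero    = subst (Valuation p 1) (sym (*-zeroʳ k)) valuation-1
  valuation-^ {k = k} v (suc e) = subst (Valuation p _) (sym (*-suc k e)) (valuation-* v (valuation-^ v e))

  valuation-exists : ∀ a → 0 < a → ∃ (Valuation p a)
  valuation-exists = <-rec _ go
    where
    go : ∀ a → (∀ {b} → b < a → 0 < b → ∃ (Valuation p b)) → 0 < a → ∃ (Valuation p a)
    go a ih a>0 with p ∣? a
    ... | no  p∤a = 0 , valuation a (sym (+-identityʳ a)) p∤a
    ... | yes (divides b refl) with ih b<b*p b>0
      where
      b>0 : 0 < b
      b>0 = ∣⇒>0 a>0 (m∣m*n p)
      b<b*p : b < b * p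
      b<b*p = m<m*n b p {{>-nonZero b>0}} (prime>1 p-prime)
    ... | k , valuation c refl p∤c = suc k , valuation c (begin
      p ^ k * c * p     ≡⟨ *-comm _ p ⟩
      p * (p ^ k * c)   ≡⟨ *-assoc p (p ^ k) c ⟨
      p * p ^ k * c     ∎) p∤c
      where open ≡-Reasoning

∣p^e*m⇒∣m : Prime p → p ∤ a → ∀ e {m} → a ∣ p ^ e * m → a ∣ m
∣p^e*m⇒∣m p-prime p∤a zero    {m} a∣m = subst (_ ∣_) (+-identityʳ m) a∣m
∣p^e*m⇒∣m {p} {a} p-prime p∤a (suc e) {m} a∣p^[1+e]*m =
  ∣p^e*m⇒∣m p-prime p∤a e
    (coprime-divisor (prime∤⇒coprime p-prime p∤a) (subst (a ∣_) (*-assoc p (p ^ e) m) a∣p^[1+e]*m))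

prodPow : (Fin t → ℕ) → (Fin t → ℕ) → ℕ
prodPow p γ = prodF (λ j → p j ^ γ j)

prodPow-^ : (p γ : Fin t → ℕ) → ∀ e → prodPow p γ ^ e ≡ prodPow p (λ j → γ j * e)
prodPow-^ p γ e = trans (prodF-^ (λ j → p j ^ γ j) e) (prodF-cong _ _ (λ j → ^-*-assoc (p j) (γ j) e))

prodPow-mono-∣ : (p : Fin t → ℕ) → ∀ {γ δ} → (∀ j → γ j ≤ δ j) → prodPow p γ ∣ prodPow p δ
prodPow-mono-∣ p γ≤δ = prodF-pres-∣ _ _ (λ j → ^-monoʳ-∣ (p j) (γ≤δ j))

prodPow>0 : (p : Fin t → ℕ) → (∀ j → Prime (p j)) → ∀ γ → 0 < prodPow p γ
prodPow>0 p p-prime γ =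
  prodF>0 _ (λ j → m^n>0 (p j) {{prime⇒nonZero (p-prime j)}} (γ j))

valuation-prodPow-other : Prime r → (p : Fin t → ℕ) → (∀ j → Prime (p j)) → (∀ j → r ≢ p j)
  → ∀ γ → Valuation r (prodPow p γ) 0
valuation-prodPow-other {t = zero}  r-prime p p-prime r≢p γ = valuation-1 r-prime
valuation-prodPow-other {t = suc t} r-prime p p-prime r≢p γ =
  valuation-* r-prime (valuation-^ r-prime (valuation-prime r-prime (p-prime zero) (r≢p zero)) (γ zero))
    (valuation-prodPow-other r-prime (p ∘ suc) (p-prime ∘ suc) (r≢p ∘ suc) (γ ∘ suc))

valuation-prodPow : (p : Fin t → ℕ) → (∀ j → Prime (p j)) → (∀ j k → p j ≡ p k → j ≡ k)
  → ∀ γ j → Valuation (p j) (prodPow p γ) (γ j)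
valuation-prodPow p p-prime p-inj γ zero =
  subst (Valuation (p zero) _) (trans (+-identityʳ _) (+-identityʳ (γ zero)))
    (valuation-* (p-prime zero) (valuation-^ (p-prime zero) (valuation-self (p-prime zero)) (γ zero))
      (valuation-prodPow-other (p-prime zero) (p ∘ suc) (p-prime ∘ suc)
        (λ j p₀≡p₁₊ⱼ → Fin.0≢1+n (p-inj zero (suc j) p₀≡p₁₊ⱼ)) (γ ∘ suc)))
valuation-prodPow p p-prime p-inj γ (suc j) =
  valuation-* (p-prime (suc j))
    (valuation-^ (p-prime (suc j)) (valuation-prime (p-prime (suc j)) (p-prime zero)
      (λ p₁₊ⱼ≡p₀ → Fin.0≢1+n (sym (p-inj (suc j) zero p₁₊ⱼ≡p₀)))) (γ zero))
    (valuation-prodPow (p ∘ suc) (p-prime ∘ suc)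
      (λ j k → Fin.suc-injective ∘ p-inj (suc j) (suc k)) (γ ∘ suc) j)

∣prodPow⇒prodPow : (p : Fin t → ℕ) → (∀ j → Prime (p j)) → ∀ β
  → a ∣ prodPow p β → ∃ λ γ → a ≡ prodPow p γ
∣prodPow⇒prodPow {t = zero}  p p-prime β a∣1 = (λ ()) , ∣1⇒≡1 a∣1
∣prodPow⇒prodPow {t = suc t} {a} p p-prime β a∣pβ
  with valuation-exists (p-prime zero) a (∣⇒>0 (prodPow>0 p p-prime β) a∣pβ)
... | k , valuation c refl p₀∤c with ∣prodPow⇒prodPow (p ∘ suc) (p-prime ∘ suc) (β ∘ suc) c∣rest
  where
  c∣rest : c ∣ prodPow (p ∘ suc) (β ∘ suc)
  c∣rest = ∣p^e*m⇒∣m (p-prime zero) p₀∤c (β zero) (∣-trans (n∣m*n (p zero ^ k)) a∣pβ)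
... | γ , refl = k ∷ γ , refl

∣prodPow⇒≡prodPow : (p : Fin t → ℕ) → (∀ j → Prime (p j)) → (∀ j k → p j ≡ p k → j ≡ k)
  → ∀ β {κ} → a ∣ prodPow p β → (∀ j → Valuation (p j) a (κ j)) → a ≡ prodPow p κ
∣prodPow⇒≡prodPow p p-prime p-inj β a∣pβ v with ∣prodPow⇒prodPow p p-prime β a∣pβ
... | γ , refl = prodF-cong _ _ (λ j →
  cong (p j ^_) (valuation-unique (p-prime j) (valuation-prodPow p p-prime p-inj γ j) (v j)))

module Weights {n} (q : Fin (suc n) → ℕ) (q>0 : ∀ i → 0 < q i) where

  g : ℕ
  g = gcdF q

  q̄ : Fin (suc n) → ℕ
  q̄ i = q i div g

  g>0 : 0 < g
  g>0 = ∣⇒>0 (q>0 zero) (gcdF∣ q zero)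

  private
    instance
      g≢0 : NonZero g
      g≢0 = >-nonZero g>0

  q̄*g≡q : ∀ i → q̄ i * g ≡ q i
  q̄*g≡q i = div*≡ (q i) g>0 (gcdF∣ q i)

  q̄>0 : ∀ i → 0 < q̄ i
  q̄>0 i = ∣⇒>0 (q>0 i) (divides g (trans (sym (q̄*g≡q i)) (*-comm (q̄ i) g)))

  q̄[i]*q[j]≡q̄[j]*q[i] : ∀ i j → q̄ i * q j ≡ q̄ j * q i
  q̄[i]*q[j]≡q̄[j]*q[i] i j = begin
    q̄ i * q j         ≡⟨ cong (q̄ i *_) (q̄*g≡q j) ⟨
    q̄ i * (q̄ j * g)   ≡⟨ x∙yz≈y∙xz (q̄ i) (q̄ j) g ⟩
    q̄ j * (q̄ i * g)   ≡⟨ cong (q̄ j *_) (q̄*g≡q i) ⟩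
    q̄ j * q i         ∎
    where open ≡-Reasoning

  proportional⇒multiple : (κ : Fin (suc n) → ℕ) → (∀ i j → κ i * q j ≡ κ j * q i)
    → ∃ λ s → ∀ i → κ i ≡ s * q̄ i
  proportional⇒multiple κ κ∝q with *-cancelʳ-∣ {n = κ zero} g q̄₀*g∣κ₀*g
    where
    q₀∣κ₀*g : q zero ∣ κ zero * g
    q₀∣κ₀*g = subst (q zero ∣_) (sym (c*gcdF≡gcdF[c*] (κ zero) q))
      (gcdF-greatest _ (λ j → divides (κ j) (κ∝q zero j)))
    q̄₀*g∣κ₀*g : q̄ zero * g ∣ κ zero * g
    q̄₀*g∣κ₀*g = subst (_∣ κ zero * g) (sym (q̄*g≡q zero)) q₀∣κ₀*g
  ... | divides s κ₀≡s*q̄₀ = s , λ i →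
    *-cancelʳ-≡ (κ i) (s * q̄ i) (q zero) {{>-nonZero (q>0 zero)}} (begin
    κ i * q zero         ≡⟨ κ∝q i zero ⟩
    κ zero * q i         ≡⟨ cong (_* q i) κ₀≡s*q̄₀ ⟩
    s * q̄ zero * q i     ≡⟨ *-assoc s (q̄ zero) (q i) ⟩
    s * (q̄ zero * q i)   ≡⟨ cong (s *_) (q̄[i]*q[j]≡q̄[j]*q[i] zero i) ⟩
    s * (q̄ i * q zero)   ≡⟨ *-assoc s (q̄ i) (q zero) ⟨
    s * q̄ i * q zero     ∎)
    where open ≡-Reasoning

  ^q̄-isPowerTuple : ∀ {D} → 0 < D → IsPowerTuple q (λ i → D ^ q̄ i)
  ^q̄-isPowerTuple {D} D>0 = (λ i → m^n>0 D {{>-nonZero D>0}} (q̄ i)) , λ i j → begin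
    (D ^ q̄ i) ^ q j   ≡⟨ ^-*-assoc D (q̄ i) (q j) ⟩
    D ^ (q̄ i * q j)   ≡⟨ cong (D ^_) (q̄[i]*q[j]≡q̄[j]*q[i] i j) ⟩
    D ^ (q̄ j * q i)   ≡⟨ ^-*-assoc D (q̄ j) (q i) ⟨
    (D ^ q̄ j) ^ q i   ∎
    where open ≡-Reasoning

  valuation-powerTuple : Prime p → ∀ {y} → IsPowerTuple q y → ∃ λ s → ∀ i → Valuation p (y i) (s * q̄ i)
  valuation-powerTuple {p} p-prime {y} (y>0 , y-cross) =
    map₂ (λ κ≡s*q̄ i → subst (Valuation p (y i)) (κ≡s*q̄ i) (proj₂ (v i))) (proportional⇒multiple κ κ∝q)
    where
    v : ∀ i → ∃ (Valuation p (y i))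
    v i = valuation-exists p-prime (y i) (y>0 i)
    κ : Fin (suc n) → ℕ
    κ = proj₁ ∘ v
    κ∝q : ∀ i j → κ i * q j ≡ κ j * q i
    κ∝q i j = valuation-unique p-prime (valuation-^ p-prime (proj₂ (v i)) (q j))
      (subst (λ z → Valuation p z (κ j * q i)) (sym (y-cross i j))
        (valuation-^ p-prime (proj₂ (v j)) (q i)))

module Awgcd {n t} (q : Fin (suc n) → ℕ) (q>0 : ∀ i → 0 < q i)
  (p : Fin t → ℕ) (p-prime : ∀ j → Prime (p j)) (p-inj : ∀ j k → p j ≡ p k → j ≡ k)
  (α : Fin t → Fin (suc n) → ℕ) where

  open Weights q q>0

  x : Fin (suc n) → ℕ
  x i = prodPow p (λ j → α j i)

  -- α̂ j is the paper's α_j, and D = awgcd(x)^q.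
  α̂ : Fin t → ℕ
  α̂ j = minF (λ i → α j i div q̄ i)

  D : ℕ
  D = prodPow p α̂

  admissible : Admissible q x (λ i → D ^ q̄ i)
  admissible = ^q̄-isPowerTuple (prodPow>0 p p-prime α̂) , λ i →
    subst (_∣ x i) (sym (prodPow-^ p α̂ (q̄ i))) (prodPow-mono-∣ p (λ j → minF-div*≤ (α j) q̄ i (q̄>0 i)))

  admissible⇒∣ : ∀ {y} → Admissible q x y → y zero ∣ D ^ q̄ zero
  admissible⇒∣ {y} (y-tuple , y∣x) = begin
    y zero                            ≡⟨ y₀≡prodPow ⟩
    prodPow p (λ j → s j * q̄ zero)   ∣⟨ prodPow-mono-∣ p (λ j → *-monoˡ-≤ (q̄ zero) (s≤α̂ j)) ⟩
    prodPow p (λ j → α̂ j * q̄ zero)   ≡⟨ prodPow-^ p α̂ (q̄ zero) ⟨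
    D ^ q̄ zero                        ∎
    where
    open ∣-Reasoning
    s : Fin t → ℕ
    s j = proj₁ (valuation-powerTuple (p-prime j) y-tuple)
    v : ∀ j i → Valuation (p j) (y i) (s j * q̄ i)
    v j = proj₂ (valuation-powerTuple (p-prime j) y-tuple)
    y₀≡prodPow : y zero ≡ prodPow p (λ j → s j * q̄ zero)
    y₀≡prodPow = ∣prodPow⇒≡prodPow p p-prime p-inj (λ j → α j zero) (y∣x zero) (λ j → v j zero)
    s≤α̂ : ∀ j → s j ≤ α̂ j
    s≤α̂ j = *≤⇒≤minF-div (α j) q̄ q̄>0 (λ i →
      valuation-mono-∣ (p-prime j) (v j i) (valuation-prodPow p p-prime p-inj (λ j → α j i) j) (y∣x i))

mainTheorem3 : (n t : ℕ) (q : Fin (suc n) → ℕ) → (∀ i → 0 < q i)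
    → (p : Fin t → ℕ) → (∀ j → Prime (p j)) → (∀ j k → p j ≡ p k → j ≡ k)
    → (α : Fin t → Fin (suc n) → ℕ)
    → IsAwgcd q (λ i → prodF (λ j → p j ^ α j i))
        (λ i → prodF (λ j → p j ^ minF (λ k → α j k div (q k div gcdF q))) ^ (q i div gcdF q))
mainTheorem3 n t q q>0 p p-prime p-inj α = admissible , λ _ y-admissible →
  ∣⇒≤ {{>-nonZero (proj₁ (proj₁ admissible) zero)}} (admissible⇒∣ y-admissible)
  where open Awgcd q q>0 p p-prime p-inj α
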